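{- Let $3\le n<\omega$ and let $\mathbf K$ be a finitely generated lattice elementarily equivalent to the free lattice $\mathbf F_n$. Then every element of $\mathbf K$ is the join of at most $3$ join irreducible elements of $\mathbf K$.
   Context: An element $a$ of a lattice is join irreducible if $a=b\vee c$ implies $a=b$ or $a=c$. -}

module Defs where

open import Level using (Level; _⊔_; 0ℓ; Lift)
open import Data.Nat using (ℕ; suc)
open import Data.Fin using (Fin; zero; suc)
open import Data.List using (List)
open import Data.List.Membership.Propositional using (_∈_)
open import Data.Product using (Σ; ∃; _×_; _,_)
open import Data.Sum using (_⊎_)
open import Data.Empty.Polymorphic using (⊥)
open import Relation.Binary.Structures using (IsEquivalence)
open import Algebra.Lattice.Bundles using (Lattice)
open import Algebra.Lattice.Structures using (IsLattice)

infixr 7 _∧ₜ_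
infixr 6 _∨ₜ_

data Term (V : Set) : Set where
  var  : V → Term V
  _∨ₜ_ : Term V → Term V → Term V
  _∧ₜ_ : Term V → Term V → Term V

module _ {c ℓ : Level} (L : Lattice c ℓ) where
  open Lattice L

  ⟦_⟧ₜ : {V : Set} → Term V → (V → Carrier) → Carrier
  ⟦ var v ⟧ₜ ρ = ρ v
  ⟦ s ∨ₜ t ⟧ₜ ρ = ⟦ s ⟧ₜ ρ ∨ ⟦ t ⟧ₜ ρ
  ⟦ s ∧ₜ t ⟧ₜ ρ = ⟦ s ⟧ₜ ρ ∧ ⟦ t ⟧ₜ ρ

  FinitelyGenerated : Set (c ⊔ ℓ)
  FinitelyGenerated =
    Σ ℕ λ m → Σ (Fin m → Carrier) λ g →
      (x : Carrier) → Σ (Term (Fin m)) λ t → x ≈ ⟦ t ⟧ₜ g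

  JoinIrreducible : Carrier → Set (c ⊔ ℓ)
  JoinIrreducible a = ∀ b c → a ≈ b ∨ c → (a ≈ b) ⊎ (a ≈ c)

-- The free lattice F_n: lattice terms in n generators modulo the
-- equational theory of lattices (derivable equality).

infix 4 _≈F_

data _≈F_ {n : ℕ} : Term (Fin n) → Term (Fin n) → Set where
  ≈refl   : ∀ {s} → s ≈F s
  ≈sym    : ∀ {s t} → s ≈F t → t ≈F s
  ≈trans  : ∀ {s t u} → s ≈F t → t ≈F u → s ≈F u
  ∨-cong' : ∀ {s s' t t'} → s ≈F s' → t ≈F t' → s ∨ₜ t ≈F s' ∨ₜ t'
  ∧-cong' : ∀ {s s' t t'} → s ≈F s' → t ≈F t' → s ∧ₜ t ≈F s' ∧ₜ t'
  ∨-comm'  : ∀ s t → s ∨ₜ t ≈F t ∨ₜ s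
  ∧-comm'  : ∀ s t → s ∧ₜ t ≈F t ∧ₜ s
  ∨-assoc' : ∀ s t u → (s ∨ₜ t) ∨ₜ u ≈F s ∨ₜ (t ∨ₜ u)
  ∧-assoc' : ∀ s t u → (s ∧ₜ t) ∧ₜ u ≈F s ∧ₜ (t ∧ₜ u)
  ∨-abs-∧' : ∀ s t → s ∨ₜ (s ∧ₜ t) ≈F s
  ∧-abs-∨' : ∀ s t → s ∧ₜ (s ∨ₜ t) ≈F s

FreeLattice : ℕ → Lattice 0ℓ 0ℓ
FreeLattice n = record
  { Carrier = Term (Fin n)
  ; _≈_ = _≈F_
  ; _∨_ = _∨ₜ_
  ; _∧_ = _∧ₜ_
  ; isLattice = record
    { isEquivalence = record { refl = ≈refl ; sym = ≈sym ; trans = ≈trans }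
    ; ∨-comm = ∨-comm'
    ; ∨-assoc = ∨-assoc'
    ; ∨-cong = ∨-cong'
    ; ∧-comm = ∧-comm'
    ; ∧-assoc = ∧-assoc'
    ; ∧-cong = ∧-cong'
    ; absorptive = ∨-abs-∧' , ∧-abs-∨'
    }
  }

-- First-order logic in the language of lattices {∨, ∧} with equality.
-- Formula k = formulas with free variables among Fin k (de Bruijn).

data Formula : ℕ → Set where
  _≐_  : ∀ {k} → Term (Fin k) → Term (Fin k) → Formula k
  ⊥'   : ∀ {k} → Formula k
  _⇒_  : ∀ {k} → Formula k → Formula k → Formula k
  _&_  : ∀ {k} → Formula k → Formula k → Formula k
  _∣_  : ∀ {k} → Formula k → Formula k → Formula k
  ∀'   : ∀ {k} → Formula (suc k) → Formula k
  ∃'   : ∀ {k} → Formula (suc k) → Formula k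

Sentence : Set
Sentence = Formula 0

extend : ∀ {a} {A : Set a} {k} → A → (Fin k → A) → Fin (suc k) → A
extend x ρ zero = x
extend x ρ (suc i) = ρ i

-- Tarski satisfaction (read classically)
module _ {c ℓ : Level} (L : Lattice c ℓ) where
  open Lattice L

  Sat : ∀ {k} → Formula k → (Fin k → Carrier) → Set (c ⊔ ℓ)
  Sat (s ≐ t) ρ = Lift c (⟦ L ⟧ₜ s ρ ≈ ⟦ L ⟧ₜ t ρ)
  Sat ⊥' ρ = ⊥
  Sat (φ ⇒ ψ) ρ = Sat φ ρ → Sat ψ ρ
  Sat (φ & ψ) ρ = Sat φ ρ × Sat ψ ρ
  Sat (φ ∣ ψ) ρ = Sat φ ρ ⊎ Sat ψ ρ
  Sat (∀' φ) ρ = (x : Carrier) → Sat φ (extend x ρ)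
  Sat (∃' φ) ρ = Σ Carrier λ x → Sat φ (extend x ρ)

  _⊨_ : Sentence → Set (c ⊔ ℓ)
  _⊨_ φ = Sat φ (λ ())

_≡ₑ_ : ∀ {c ℓ c' ℓ'} → Lattice c ℓ → Lattice c' ℓ' → Set (c ⊔ ℓ ⊔ c' ⊔ ℓ')
K ≡ₑ M = (φ : Sentence) → (K ⊨ φ → M ⊨ φ) × (M ⊨ φ → K ⊨ φ)

{-# OPTIONS --safe #-}
-- Whitman's condition (W): u ∧ v ≤ b ∨ d implies u ≤ b ∨ d, v ≤ b ∨ d, u ∧ v ≤ b or
-- u ∧ v ≤ d.  It is a first-order sentence, it holds in every free lattice (read it off
-- the last rule of a cut-free derivation in Whitman's sequent calculus), hence in K.
-- Under (W) a meet u ∧ v is join irreducible unless it equals u or v.  Applied to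
-- q = (c ∨ d) ∧ (c ∨ p) this shows that (c ∨ d) ∨ p is c ∨ d, c ∨ p or q ∨ (d ∨ p), so
-- joins of three join irreducibles are closed under joining a join irreducible, hence
-- under joins.  The value of a term then is such a join as soon as the generators below
-- it are, and the generators are handled by induction along the strict order on the
-- finitely many of them: a generator that is not join irreducible is the join of two
-- strictly smaller elements.
module Submission where

open import Defs
open import Level using (Level; _⊔_; lift; lower)
open import Data.Nat using (ℕ)
open import Data.Fin using (Fin; zero; suc)
open import Data.Product using (Σ; _×_; _,_; proj₁; proj₂; swap; zip′)
open import Data.Sum using (_⊎_; inj₁; inj₂; map)
open import Function using (flip; _∘_)
open import Relation.Nullary using (yes; no; contradiction)
open import Axiom.ExcludedMiddle using (ExcludedMiddle)
open import Algebra.Lattice.Bundles using (Lattice)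
import Algebra.Lattice.Properties.Lattice as LatticeProperties
open import Relation.Binary.Bundles using (Poset)
import Relation.Binary.Lattice as OrderTheoretic
import Relation.Binary.Properties.Poset as PosetProperties
import Relation.Binary.Lattice.Properties.JoinSemilattice as JoinSemilatticeProperties
import Relation.Binary.Reasoning.PartialOrder as PartialOrderReasoning
import Relation.Binary.Construct.On as On
open import Data.Fin.Induction using (po-wellFounded)
open import Induction.WellFounded using (module All)

Whitman : ∀ {c ℓ} → Lattice c ℓ → Set (c ⊔ ℓ)
Whitman L = ∀ u v b d → u ∧ v ≤ b ∨ d →
              u ≤ b ∨ d ⊎ v ≤ b ∨ d ⊎ u ∧ v ≤ b ⊎ u ∧ v ≤ d
  where
  open Lattice L
  open Poset (LatticeProperties.poset L) using (_≤_)

infix 4 _≤ₜ_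

_≤ₜ_ : ∀ {k} → Term (Fin k) → Term (Fin k) → Formula k
s ≤ₜ t = s ≐ (s ∧ₜ t)

whitmanSentence : Sentence
whitmanSentence = ∀' (∀' (∀' (∀' ((u ∧ₜ v ≤ₜ b ∨ₜ d) ⇒
  ((u ≤ₜ b ∨ₜ d) ∣ ((v ≤ₜ b ∨ₜ d) ∣ ((u ∧ₜ v ≤ₜ b) ∣ (u ∧ₜ v ≤ₜ d))))))))
  where
  u v b d : Term (Fin 4)
  u = var (suc (suc (suc zero)))
  v = var (suc (suc zero))
  b = var (suc zero)
  d = var zero

module _ {c ℓ} (L : Lattice c ℓ) where

  Whitman⇒⊨whitmanSentence : Whitman L → L ⊨ whitmanSentence
  Whitman⇒⊨whitmanSentence w u v b d h =
    map lift (map lift (map lift lift)) (w u v b d (lower h))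

  ⊨whitmanSentence⇒Whitman : L ⊨ whitmanSentence → Whitman L
  ⊨whitmanSentence⇒Whitman w u v b d h =
    map lower (map lower (map lower lower)) (w u v b d (lift h))

module _ {V : Set} where

  infix 4 _⊑_

  data _⊑_ : Term V → Term V → Set where
    ⊑-var : ∀ {x} → var x ⊑ var x
    ∨L    : ∀ {s t u} → s ⊑ u → t ⊑ u → s ∨ₜ t ⊑ u
    ∧R    : ∀ {s t u} → u ⊑ s → u ⊑ t → u ⊑ s ∧ₜ t
    ∨R₁   : ∀ {s u v} → s ⊑ u → s ⊑ u ∨ₜ v
    ∨R₂   : ∀ {s u v} → s ⊑ v → s ⊑ u ∨ₜ v
    ∧L₁   : ∀ {s t u} → s ⊑ u → s ∧ₜ t ⊑ u
    ∧L₂   : ∀ {s t u} → t ⊑ u → s ∧ₜ t ⊑ u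

  ⊑-refl : ∀ t → t ⊑ t
  ⊑-refl (var x) = ⊑-var
  ⊑-refl (s ∨ₜ t) = ∨L (∨R₁ (⊑-refl s)) (∨R₂ (⊑-refl t))
  ⊑-refl (s ∧ₜ t) = ∧R (∧L₁ (⊑-refl s)) (∧L₂ (⊑-refl t))

  ⊑-trans : ∀ {s t u} → s ⊑ t → t ⊑ u → s ⊑ u
  ⊑-trans (∨L p q) r = ∨L (⊑-trans p r) (⊑-trans q r)
  ⊑-trans (∧L₁ p) r = ∧L₁ (⊑-trans p r)
  ⊑-trans (∧L₂ p) r = ∧L₂ (⊑-trans p r)
  ⊑-trans ⊑-var r = r
  ⊑-trans p (∧R q r) = ∧R (⊑-trans p q) (⊑-trans p r)
  ⊑-trans p (∨R₁ q) = ∨R₁ (⊑-trans p q)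
  ⊑-trans p (∨R₂ q) = ∨R₂ (⊑-trans p q)
  ⊑-trans (∨R₁ p) (∨L q _) = ⊑-trans p q
  ⊑-trans (∨R₂ p) (∨L _ q) = ⊑-trans p q
  ⊑-trans (∧R p _) (∧L₁ q) = ⊑-trans p q
  ⊑-trans (∧R _ p) (∧L₂ q) = ⊑-trans p q

  ∨-mono-⊑ : ∀ {s s′ t t′} → s ⊑ s′ → t ⊑ t′ → s ∨ₜ t ⊑ s′ ∨ₜ t′
  ∨-mono-⊑ p q = ∨L (∨R₁ p) (∨R₂ q)

  ∧-mono-⊑ : ∀ {s s′ t t′} → s ⊑ s′ → t ⊑ t′ → s ∧ₜ t ⊑ s′ ∧ₜ t′
  ∧-mono-⊑ p q = ∧R (∧L₁ p) (∧L₂ q)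

module _ {n : ℕ} where

  ≈F⇒⊑⊒ : {s t : Term (Fin n)} → s ≈F t → s ⊑ t × t ⊑ s
  ≈F⇒⊑⊒ {s} ≈refl = ⊑-refl s , ⊑-refl s
  ≈F⇒⊑⊒ (≈sym e) = swap (≈F⇒⊑⊒ e)
  ≈F⇒⊑⊒ (≈trans e f) = zip′ ⊑-trans (flip ⊑-trans) (≈F⇒⊑⊒ e) (≈F⇒⊑⊒ f)
  ≈F⇒⊑⊒ (∨-cong' e f) = zip′ ∨-mono-⊑ ∨-mono-⊑ (≈F⇒⊑⊒ e) (≈F⇒⊑⊒ f)
  ≈F⇒⊑⊒ (∧-cong' e f) = zip′ ∧-mono-⊑ ∧-mono-⊑ (≈F⇒⊑⊒ e) (≈F⇒⊑⊒ f)
  ≈F⇒⊑⊒ (∨-comm' s t) = ∨L (∨R₂ (⊑-refl s)) (∨R₁ (⊑-refl t)) , ∨L (∨R₂ (⊑-refl t)) (∨R₁ (⊑-refl s))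
  ≈F⇒⊑⊒ (∧-comm' s t) = ∧R (∧L₂ (⊑-refl t)) (∧L₁ (⊑-refl s)) , ∧R (∧L₂ (⊑-refl s)) (∧L₁ (⊑-refl t))
  ≈F⇒⊑⊒ (∨-assoc' s t u) =
    ∨L (∨L (∨R₁ (⊑-refl s)) (∨R₂ (∨R₁ (⊑-refl t)))) (∨R₂ (∨R₂ (⊑-refl u))) ,
    ∨L (∨R₁ (∨R₁ (⊑-refl s))) (∨L (∨R₁ (∨R₂ (⊑-refl t))) (∨R₂ (⊑-refl u)))
  ≈F⇒⊑⊒ (∧-assoc' s t u) =
    ∧R (∧L₁ (∧L₁ (⊑-refl s))) (∧R (∧L₁ (∧L₂ (⊑-refl t))) (∧L₂ (⊑-refl u))) ,
    ∧R (∧R (∧L₁ (⊑-refl s)) (∧L₂ (∧L₁ (⊑-refl t)))) (∧L₂ (∧L₂ (⊑-refl u)))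
  ≈F⇒⊑⊒ (∨-abs-∧' s t) = ∨L (⊑-refl s) (∧L₁ (⊑-refl s)) , ∨R₁ (⊑-refl s)
  ≈F⇒⊑⊒ (∧-abs-∨' s t) = ∧L₁ (⊑-refl s) , ∧R (⊑-refl s) (∨R₁ (⊑-refl s))

  open OrderTheoretic.Lattice (LatticeProperties.∨-∧-orderTheoreticLattice (FreeLattice n))
    using (_≤_; x≤x∨y; y≤x∨y; ∨-least; x∧y≤x; x∧y≤y; ∧-greatest)
    renaming (refl to ≤-refl; trans to ≤-trans)

  ⊑⇒≤ : {s t : Term (Fin n)} → s ⊑ t → s ≤ t
  ⊑⇒≤ ⊑-var = ≤-refl
  ⊑⇒≤ (∨L p q) = ∨-least (⊑⇒≤ p) (⊑⇒≤ q)
  ⊑⇒≤ (∧R p q) = ∧-greatest (⊑⇒≤ p) (⊑⇒≤ q)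
  ⊑⇒≤ (∨R₁ p) = ≤-trans (⊑⇒≤ p) (x≤x∨y _ _)
  ⊑⇒≤ (∨R₂ p) = ≤-trans (⊑⇒≤ p) (y≤x∨y _ _)
  ⊑⇒≤ (∧L₁ p) = ≤-trans (x∧y≤x _ _) (⊑⇒≤ p)
  ⊑⇒≤ (∧L₂ p) = ≤-trans (x∧y≤y _ _) (⊑⇒≤ p)

  ≤⇒⊑ : {s t : Term (Fin n)} → s ≤ t → s ⊑ t
  ≤⇒⊑ {s} {t} s≈s∧t = ⊑-trans (proj₁ (≈F⇒⊑⊒ s≈s∧t)) (∧L₂ (⊑-refl t))

  freeLattice-whitman : Whitman (FreeLattice n)
  freeLattice-whitman u v b d u∧v≤b∨d with ≤⇒⊑ u∧v≤b∨d
  ... | ∧L₁ p = inj₁ (⊑⇒≤ p)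
  ... | ∧L₂ p = inj₂ (inj₁ (⊑⇒≤ p))
  ... | ∨R₁ p = inj₂ (inj₂ (inj₁ (⊑⇒≤ p)))
  ... | ∨R₂ p = inj₂ (inj₂ (inj₂ (⊑⇒≤ p)))

module _ {c ℓ} (L : Lattice c ℓ) where

  open Lattice L
  open LatticeProperties L using (∨-idem)

  JoinOf3Irreducibles : Carrier → Set (c ⊔ ℓ)
  JoinOf3Irreducibles x = Σ Carrier λ a → Σ Carrier λ b → Σ Carrier λ d →
    JoinIrreducible L a × JoinIrreducible L b × JoinIrreducible L d × x ≈ a ∨ (b ∨ d)

  JoinOf3Irreducibles-resp-≈ : ∀ {x y} → x ≈ y → JoinOf3Irreducibles x → JoinOf3Irreducibles y
  JoinOf3Irreducibles-resp-≈ x≈y (a , b , d , ja , jb , jd , x≈) =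
    a , b , d , ja , jb , jd , trans (sym x≈y) x≈

  joinIrreducible⇒JoinOf3Irreducibles : ∀ {p} → JoinIrreducible L p → JoinOf3Irreducibles p
  joinIrreducible⇒JoinOf3Irreducibles {p} jp =
    p , p , p , jp , jp , jp , sym (trans (∨-cong refl (∨-idem p)) (∨-idem p))

module _ (lem : ∀ {a} → ExcludedMiddle a) {c ℓ} (L : Lattice c ℓ) (whitman : Whitman L) where

  open Lattice L
  open OrderTheoretic.Lattice (LatticeProperties.∨-∧-orderTheoreticLattice L)
    using ( poset; joinSemilattice; isPartialOrder; _≤_; antisym
          ; x≤x∨y; y≤x∨y; ∨-least; x∧y≤x; x∧y≤y; ∧-greatest )
    renaming (refl to ≤-refl; trans to ≤-trans; reflexive to ≤-reflexive)
  open PosetProperties poset using (_<_)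
  open JoinSemilatticeProperties joinSemilattice using (∨-monotonic)

  ∧-joinIrreducible⊎absorbed : ∀ u v → JoinIrreducible L (u ∧ v) ⊎ u ∧ v ≈ u ⊎ u ∧ v ≈ v
  ∧-joinIrreducible⊎absorbed u v with lem {P = u ∧ v ≈ u} | lem {P = u ∧ v ≈ v}
  ... | yes u∧v≈u | _ = inj₂ (inj₁ u∧v≈u)
  ... | no _ | yes u∧v≈v = inj₂ (inj₂ u∧v≈v)
  ... | no u∧v≉u | no u∧v≉v = inj₁ irreducible
    where
    irreducible : JoinIrreducible L (u ∧ v)
    irreducible b d u∧v≈b∨d = decide (whitman u v b d (≤-reflexive u∧v≈b∨d))
      where
      b∨d≤u∧v : b ∨ d ≤ u ∧ v
      b∨d≤u∧v = ≤-reflexive (sym u∧v≈b∨d)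

      decide : u ≤ b ∨ d ⊎ v ≤ b ∨ d ⊎ u ∧ v ≤ b ⊎ u ∧ v ≤ d → u ∧ v ≈ b ⊎ u ∧ v ≈ d
      decide (inj₁ u≤b∨d) =
        contradiction (antisym (x∧y≤x u v) (≤-trans u≤b∨d b∨d≤u∧v)) u∧v≉u
      decide (inj₂ (inj₁ v≤b∨d)) =
        contradiction (antisym (x∧y≤y u v) (≤-trans v≤b∨d b∨d≤u∧v)) u∧v≉v
      decide (inj₂ (inj₂ (inj₁ u∧v≤b))) = inj₁ (antisym u∧v≤b (≤-trans (x≤x∨y b d) b∨d≤u∧v))
      decide (inj₂ (inj₂ (inj₂ u∧v≤d))) = inj₂ (antisym u∧v≤d (≤-trans (y≤x∨y b d) b∨d≤u∧v))

  ∨-∨-trichotomy : ∀ c d p →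
    (c ∨ d) ∨ p ≈ c ∨ d ⊎ (c ∨ d) ∨ p ≈ c ∨ p ⊎
    Σ Carrier λ q → JoinIrreducible L q × (c ∨ d) ∨ p ≈ q ∨ (d ∨ p)
  ∨-∨-trichotomy c d p with ∧-joinIrreducible⊎absorbed (c ∨ d) (c ∨ p)
  ... | inj₂ (inj₂ meet≈c∨p) = inj₁ (antisym (∨-least ≤-refl p≤c∨d) (x≤x∨y _ p))
    where
    p≤c∨d : p ≤ c ∨ d
    p≤c∨d = ≤-trans (y≤x∨y c p) (≤-trans (≤-reflexive (sym meet≈c∨p)) (x∧y≤x _ _))
  ... | inj₂ (inj₁ meet≈c∨d) = inj₂ (inj₁ (antisym (∨-least c∨d≤c∨p (y≤x∨y c p)) c∨p≤c∨d∨p))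
    where
    c∨d≤c∨p : c ∨ d ≤ c ∨ p
    c∨d≤c∨p = ≤-trans (≤-reflexive (sym meet≈c∨d)) (x∧y≤y _ _)
    c∨p≤c∨d∨p : c ∨ p ≤ (c ∨ d) ∨ p
    c∨p≤c∨d∨p = ∨-monotonic (x≤x∨y c d) ≤-refl
  ... | inj₁ q-irreducible = inj₂ (inj₂ (q , q-irreducible , antisym c∨d∨p≤q∨d∨p q∨d∨p≤c∨d∨p))
    where
    q : Carrier
    q = (c ∨ d) ∧ (c ∨ p)
    c∨d∨p≤q∨d∨p : (c ∨ d) ∨ p ≤ q ∨ (d ∨ p)
    c∨d∨p≤q∨d∨p = ≤-trans (≤-reflexive (∨-assoc c d p)) (∨-monotonic c≤q ≤-refl)
      where
      c≤q : c ≤ q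
      c≤q = ∧-greatest (x≤x∨y c d) (x≤x∨y c p)
    q∨d∨p≤c∨d∨p : q ∨ (d ∨ p) ≤ (c ∨ d) ∨ p
    q∨d∨p≤c∨d∨p = ∨-least (≤-trans (x∧y≤x _ _) (x≤x∨y _ p)) (∨-monotonic (y≤x∨y c d) ≤-refl)

  joinOf4Irreducibles⇒JoinOf3Irreducibles : ∀ {a b d p} →
    JoinIrreducible L a → JoinIrreducible L b → JoinIrreducible L d → JoinIrreducible L p →
    JoinOf3Irreducibles L (((a ∨ b) ∨ d) ∨ p)
  joinOf4Irreducibles⇒JoinOf3Irreducibles {a} {b} {d} {p} ja jb jd jp
    with ∨-∨-trichotomy (a ∨ b) d p
  ... | inj₁ ≈a∨b∨d = a , b , d , ja , jb , jd , trans ≈a∨b∨d (∨-assoc a b d)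
  ... | inj₂ (inj₁ ≈a∨b∨p) = a , b , p , ja , jb , jp , trans ≈a∨b∨p (∨-assoc a b p)
  ... | inj₂ (inj₂ (q , jq , ≈q∨d∨p)) = q , d , p , jq , jd , jp , ≈q∨d∨p

  JoinOf3Irreducibles-∨-joinIrreducible : ∀ {x p} →
    JoinOf3Irreducibles L x → JoinIrreducible L p → JoinOf3Irreducibles L (x ∨ p)
  JoinOf3Irreducibles-∨-joinIrreducible {x} {p} (a , b , d , ja , jb , jd , x≈a∨b∨d) jp =
    JoinOf3Irreducibles-resp-≈ L (∨-cong (sym x≈[a∨b]∨d) refl)
      (joinOf4Irreducibles⇒JoinOf3Irreducibles ja jb jd jp)
    where
    x≈[a∨b]∨d : x ≈ (a ∨ b) ∨ d
    x≈[a∨b]∨d = trans x≈a∨b∨d (sym (∨-assoc a b d))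

  JoinOf3Irreducibles-∨ : ∀ {x y} →
    JoinOf3Irreducibles L x → JoinOf3Irreducibles L y → JoinOf3Irreducibles L (x ∨ y)
  JoinOf3Irreducibles-∨ {x} {y} x-join (a , b , d , ja , jb , jd , y≈a∨b∨d) =
    JoinOf3Irreducibles-resp-≈ L [[x∨a]∨b]∨d≈x∨y
      (JoinOf3Irreducibles-∨-joinIrreducible
        (JoinOf3Irreducibles-∨-joinIrreducible
          (JoinOf3Irreducibles-∨-joinIrreducible x-join ja) jb) jd)
    where
    [[x∨a]∨b]∨d≈x∨y : ((x ∨ a) ∨ b) ∨ d ≈ x ∨ y
    [[x∨a]∨b]∨d≈x∨y = trans (∨-assoc _ _ _) (trans (∨-assoc _ _ _) (∨-cong refl (sym y≈a∨b∨d)))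

  JoinOf3Irreducibles-from-below : ∀ x →
    (∀ {y} → y < x → JoinOf3Irreducibles L y) → JoinOf3Irreducibles L x
  JoinOf3Irreducibles-from-below x below with lem {P = JoinOf3Irreducibles L x}
  ... | yes x-join = x-join
  ... | no ¬x-join = contradiction (joinIrreducible⇒JoinOf3Irreducibles L irreducible) ¬x-join
    where
    irreducible : JoinIrreducible L x
    irreducible b d x≈b∨d with lem {P = x ≈ b} | lem {P = x ≈ d}
    ... | yes x≈b | _ = inj₁ x≈b
    ... | no _ | yes x≈d = inj₂ x≈d
    ... | no x≉b | no x≉d =
      contradiction b∨d-join (¬x-join ∘ JoinOf3Irreducibles-resp-≈ L (sym x≈b∨d))
      where
      b∨d-join : JoinOf3Irreducibles L (b ∨ d)
      b∨d-join = JoinOf3Irreducibles-∨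
        (below (≤-trans (x≤x∨y b d) (≤-reflexive (sym x≈b∨d)) , x≉b ∘ sym))
        (below (≤-trans (y≤x∨y b d) (≤-reflexive (sym x≈b∨d)) , x≉d ∘ sym))

  GeneratorsBelowAreJoinsOf3 : ∀ {V : Set} → (V → Carrier) → Carrier → Set (c ⊔ ℓ)
  GeneratorsBelowAreJoinsOf3 g x = ∀ i → g i ≤ x → JoinOf3Irreducibles L (g i)

  ⟦⟧-JoinOf3Irreducibles : ∀ {V} (g : V → Carrier) t →
    GeneratorsBelowAreJoinsOf3 g (⟦ L ⟧ₜ t g) → JoinOf3Irreducibles L (⟦ L ⟧ₜ t g)
  ⟦⟧-JoinOf3Irreducibles g (var i) gens = gens i ≤-refl
  ⟦⟧-JoinOf3Irreducibles g (s ∨ₜ t) gens = JoinOf3Irreducibles-∨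
    (⟦⟧-JoinOf3Irreducibles g s (λ i gi≤s → gens i (≤-trans gi≤s (x≤x∨y _ _))))
    (⟦⟧-JoinOf3Irreducibles g t (λ i gi≤t → gens i (≤-trans gi≤t (y≤x∨y _ _))))
  ⟦⟧-JoinOf3Irreducibles g (s ∧ₜ t) gens
    with ∧-joinIrreducible⊎absorbed (⟦ L ⟧ₜ s g) (⟦ L ⟧ₜ t g)
  ... | inj₁ irreducible = joinIrreducible⇒JoinOf3Irreducibles L irreducible
  ... | inj₂ (inj₁ s∧t≈s) = JoinOf3Irreducibles-resp-≈ L (sym s∧t≈s)
    (⟦⟧-JoinOf3Irreducibles g s (λ i gi≤s → gens i (≤-trans gi≤s (≤-reflexive (sym s∧t≈s)))))
  ... | inj₂ (inj₂ s∧t≈t) = JoinOf3Irreducibles-resp-≈ L (sym s∧t≈t)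
    (⟦⟧-JoinOf3Irreducibles g t (λ i gi≤t → gens i (≤-trans gi≤t (≤-reflexive (sym s∧t≈t)))))

  module _ {m} (g : Fin m → Carrier)
           (generates : ∀ x → Σ (Term (Fin m)) λ t → x ≈ ⟦ L ⟧ₜ t g) where

    generator-JoinOf3Irreducibles : ∀ j → JoinOf3Irreducibles L (g j)
    generator-JoinOf3Irreducibles =
      All.wfRec (po-wellFounded (On.isPartialOrder g isPartialOrder)) _
        (λ j → JoinOf3Irreducibles L (g j)) step
      where
      step : ∀ j → (∀ {i} → g i < g j → JoinOf3Irreducibles L (g i)) →
             JoinOf3Irreducibles L (g j)
      step j smaller = JoinOf3Irreducibles-from-below (g j) λ {y} y<gj →
        let (t , y≈t) = generates y in
        JoinOf3Irreducibles-resp-≈ L (sym y≈t) (⟦⟧-JoinOf3Irreducibles g t λ i gi≤t →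
          smaller (begin-strict g i ≤⟨ gi≤t ⟩ ⟦ L ⟧ₜ t g ≈⟨ sym y≈t ⟩ y <⟨ y<gj ⟩ g j ∎))
        where open PartialOrderReasoning poset

  finitelyGenerated⇒JoinOf3Irreducibles : FinitelyGenerated L → ∀ x → JoinOf3Irreducibles L x
  finitelyGenerated⇒JoinOf3Irreducibles (m , g , generates) x =
    let (t , x≈t) = generates x in
    JoinOf3Irreducibles-resp-≈ L (sym x≈t)
      (⟦⟧-JoinOf3Irreducibles g t (λ i _ → generator-JoinOf3Irreducibles g generates i))

open import Data.Nat using (_≤_)

lemma6p1 : (lem : ∀ {a} → ExcludedMiddle a) →
           {c ℓ : Level} (n : ℕ) → 3 ≤ n →
           (K : Lattice c ℓ) → FinitelyGenerated K → K ≡ₑ FreeLattice n →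
           (x : Lattice.Carrier K) →
           Σ (Lattice.Carrier K) λ a → Σ (Lattice.Carrier K) λ b → Σ (Lattice.Carrier K) λ d →
             JoinIrreducible K a × JoinIrreducible K b × JoinIrreducible K d ×
             Lattice._≈_ K x (Lattice._∨_ K a (Lattice._∨_ K b d))
lemma6p1 lem n _ K finitelyGenerated K≡Fₙ =
  finitelyGenerated⇒JoinOf3Irreducibles lem K K-whitman finitelyGenerated
  where
  K-whitman : Whitman K
  K-whitman = ⊨whitmanSentence⇒Whitman K
    (proj₂ (K≡Fₙ whitmanSentence) (Whitman⇒⊨whitmanSentence (FreeLattice n) freeLattice-whitman))
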